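{- Let $G$ be an ordered group and let $a,b,c\in G$ with $[a,c]=1$. Let $T$ be a subset of $G$ with $T\subseteq\{a,ac,ac^2,\dots,ac^h\}$ for some positive integer $h$, and suppose $b\in G\setminus T$ satisfies $|Tb\cap bT|\ge 2$. Then $\langle a,b,c\rangle$ is metabelian. Moreover, if $G$ is nilpotent, then $\langle a,b,c\rangle$ is nilpotent of class at most $2$.
   Context: An ordered group is a group $G$ with a total order $\le$ such that $a\le b$ implies $xay\le xby$ for all $a,b,x,y\in G$. $[a,c]=a^{ -1}c^{ -1}ac$; $Tb=\{tb:t\in T\}$, $bT=\{bt:t\in T\}$. A group is metabelian if its derived subgroup is abelian. -}

module Defs where

import Level
open import Level using (Level; _⊔_) renaming (suc to lsuc)
open import Algebra.Bundles using (Group)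
open import Relation.Binary.Core using (Rel)
open import Relation.Binary.Structures using (IsTotalOrder)
open import Data.Nat using (ℕ; zero; suc)
open import Data.Product using (Σ; ∃; _×_)
open import Relation.Nullary using (¬_)

record OrderedGroup (c ℓ ℓ₂ : Level) : Set (lsuc (c ⊔ ℓ ⊔ ℓ₂)) where
  field
    group        : Group c ℓ
  open Group group public
  field
    _≤_          : Rel Carrier ℓ₂
    isTotalOrder : IsTotalOrder _≈_ _≤_
    compat       : ∀ {a b} (x y : Carrier) → a ≤ b → ((x ∙ a) ∙ y) ≤ ((x ∙ b) ∙ y)

module GroupNotions {c ℓ : Level} (G : Group c ℓ) where
  open Group G

  [_,_] : Carrier → Carrier → Carrier
  [ x , y ] = ((x ⁻¹ ∙ y ⁻¹) ∙ x) ∙ y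

  pow : Carrier → ℕ → Carrier
  pow x zero    = ε
  pow x (suc n) = pow x n ∙ x

  data Closure (P : Carrier → Set (c ⊔ ℓ)) : Carrier → Set (c ⊔ ℓ) where
    inc  : ∀ {x} → P x → Closure P x
    one  : Closure P ε
    mul  : ∀ {x y} → Closure P x → Closure P y → Closure P (x ∙ y)
    inv  : ∀ {x} → Closure P x → Closure P (x ⁻¹)
    resp : ∀ {x y} → x ≈ y → Closure P x → Closure P y

  Gen3 : Carrier → Carrier → Carrier → Carrier → Set (c ⊔ ℓ)
  Gen3 a b d = Closure (λ z → Level.Lift (c ⊔ ℓ) ((z ≈ a) Data.Sum.⊎ ((z ≈ b) Data.Sum.⊎ (z ≈ d))))
    where import Data.Sum

  CommSub : (K H : Carrier → Set (c ⊔ ℓ)) → Carrier → Set (c ⊔ ℓ)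
  CommSub K H = Closure (λ z → Σ Carrier λ x → Σ Carrier λ y → K x × H y × (z ≈ [ x , y ]))

  Derived : (Carrier → Set (c ⊔ ℓ)) → Carrier → Set (c ⊔ ℓ)
  Derived H = CommSub H H

  IsAbelian : (Carrier → Set (c ⊔ ℓ)) → Set (c ⊔ ℓ)
  IsAbelian H = ∀ x y → H x → H y → (x ∙ y) ≈ (y ∙ x)

  Metabelian : (Carrier → Set (c ⊔ ℓ)) → Set (c ⊔ ℓ)
  Metabelian H = IsAbelian (Derived H)

  -- lower central series: γ H n is γ_{n+1}(H); γ_1 = H, γ_{i+1} = [γ_i , H]
  γ : (Carrier → Set (c ⊔ ℓ)) → ℕ → Carrier → Set (c ⊔ ℓ)
  γ H zero    = H
  γ H (suc n) = CommSub (γ H n) H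

  Trivial : (Carrier → Set (c ⊔ ℓ)) → Set (c ⊔ ℓ)
  Trivial K = ∀ x → K x → x ≈ ε

  NilpotentClass≤ : (Carrier → Set (c ⊔ ℓ)) → ℕ → Set (c ⊔ ℓ)
  NilpotentClass≤ H n = Trivial (γ H n)

  Whole : Carrier → Set (c ⊔ ℓ)
  Whole _ = Level.Lift (c ⊔ ℓ) Data.Unit.⊤
    where import Data.Unit

  IsNilpotentGroup : Set (c ⊔ ℓ)
  IsNilpotentGroup = ∃ λ n → NilpotentClass≤ Whole n

{-# OPTIONS --safe #-}
-- Write xᵇ = b⁻¹ x b. The two distinct elements of Tb ∩ bT give (a dᵏ)ᵇ = a dˡ and
-- (a dᵏ⁺ᵖ)ᵇ = a dʲ with p ≥ 1, hence (dᵖ)ᵇ = dʲ⁻ˡ. Roots are unique in an ordered group,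
-- so x commutes with everything that xᵖ commutes with; by induction on n the conjugates
-- of a and d by bⁿ therefore centralize a and d. Hence the conjugates of a and d by all
-- powers of b generate an abelian subgroup N, normalized by a, b, d and containing a, d;
-- as H / N is cyclic, H′ ≤ N.
-- If G is nilpotent, iterating x ↦ [x, b]ᵖ from dᵖ stays among the powers of d while
-- descending the lower central series, and the exponent stays nonzero unless j = p + l.
-- So (dᵖ)ᵇ = dᵖ, whence dᵇ = d, and [a, b] = dˡ⁻ᵏ is central in H.
module Submission where

open import Defs
import Level
open import Level using (Level; _⊔_; lift)
open import Algebra.Bundles using (Group)
open import Data.Empty using (⊥-elim)
open import Data.Nat using (ℕ; zero; suc; _+_; _*_; _≤_; _<_; _≟_)
open import Data.Nat.GeneralisedArithmetic using (fold)
open import Data.Nat.Properties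
  using (+-identityʳ; +-suc; +-comm; *-zeroʳ; *-suc; +-cancelˡ-≡; *-cancelˡ-≡; ≤-total; m≤n⇒∃[o]m+o≡n; <-cmp)
open import Data.Nat.Tactic.RingSolver using (solve-∀)
open import Data.Product using (Σ; _×_; _,_; proj₁; proj₂)
open import Data.Sum using (_⊎_; inj₁; inj₂)
open import Data.Unit using (tt)
open import Relation.Binary.Definitions using (tri<; tri≈; tri>)
open import Relation.Binary.Structures using (IsTotalOrder)
open import Relation.Nullary using (¬_; yes; no)
import Relation.Binary.PropositionalEquality as ≡
open ≡ using (_≡_)
open import Tactic.MonoidSolver using (solve)

module GroupTheory {c ℓ} (G : Group c ℓ) where
  open Group G
  open GroupNotions G
  open import Algebra.Properties.Group G
  open import Relation.Binary.Reasoning.Setoid setoid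

  Commute : Carrier → Carrier → Set ℓ
  Commute x y = x ∙ y ≈ y ∙ x

  infixl 8 _^_
  _^_ : Carrier → Carrier → Carrier
  g ^ x = x ⁻¹ ∙ g ∙ x

  ^-cong : ∀ {g g′ x x′} → g ≈ g′ → x ≈ x′ → g ^ x ≈ g′ ^ x′
  ^-cong g≈g′ x≈x′ = ∙-cong (∙-cong (⁻¹-cong x≈x′) g≈g′) x≈x′

  ^-homo : ∀ g h x → (g ∙ h) ^ x ≈ g ^ x ∙ h ^ x
  ^-homo g h x = begin
    x ⁻¹ ∙ (g ∙ h) ∙ x                ≈⟨ solve monoid ⟩
    x ⁻¹ ∙ g ∙ (h ∙ x)                ≈⟨ ∙-congˡ (\\-leftDividesˡ x (h ∙ x)) ⟨
    x ⁻¹ ∙ g ∙ (x ∙ (x ⁻¹ ∙ (h ∙ x)))  ≈⟨ solve monoid ⟩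
    x ⁻¹ ∙ g ∙ x ∙ (x ⁻¹ ∙ h ∙ x)      ∎

  ε^ : ∀ x → ε ^ x ≈ ε
  ε^ x = trans (∙-congʳ (identityʳ _)) (inverseˡ x)

  ^ε : ∀ g → g ^ ε ≈ g
  ^ε g = trans (identityʳ _) (trans (∙-congʳ ε⁻¹≈ε) (identityˡ g))

  ^-^ : ∀ g x y → g ^ x ^ y ≈ g ^ (x ∙ y)
  ^-^ g x y = begin
    y ⁻¹ ∙ (x ⁻¹ ∙ g ∙ x) ∙ y  ≈⟨ solve monoid ⟩
    y ⁻¹ ∙ x ⁻¹ ∙ g ∙ (x ∙ y)  ≈⟨ ∙-congʳ (∙-congʳ (⁻¹-anti-homo-∙ x y)) ⟨
    (x ∙ y) ⁻¹ ∙ g ∙ (x ∙ y)   ∎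

  ^-^⁻¹ : ∀ g x → g ^ x ^ (x ⁻¹) ≈ g
  ^-^⁻¹ g x = trans (^-^ g x (x ⁻¹)) (trans (^-cong refl (inverseʳ x)) (^ε g))

  ^⁻¹-^ : ∀ g x → g ^ (x ⁻¹) ^ x ≈ g
  ^⁻¹-^ g x = trans (^-^ g (x ⁻¹) x) (trans (^-cong refl (inverseˡ x)) (^ε g))

  ⁻¹-^ : ∀ g x → g ⁻¹ ^ x ≈ (g ^ x) ⁻¹
  ⁻¹-^ g x = inverseʳ-unique (g ^ x) (g ⁻¹ ^ x) (begin
    g ^ x ∙ g ⁻¹ ^ x   ≈⟨ ^-homo g (g ⁻¹) x ⟨
    (g ∙ g ⁻¹) ^ x     ≈⟨ ^-cong (inverseʳ g) refl ⟩
    ε ^ x              ≈⟨ ε^ x ⟩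
    ε                  ∎)

  pow-^ : ∀ g x n → pow g n ^ x ≈ pow (g ^ x) n
  pow-^ g x zero    = ε^ x
  pow-^ g x (suc n) = trans (^-homo (pow g n) g x) (∙-congʳ (pow-^ g x n))

  ^-Commute : ∀ {g h} x → Commute g h → Commute (g ^ x) (h ^ x)
  ^-Commute {g} {h} x gh≈hg =
    trans (sym (^-homo g h x)) (trans (^-cong gh≈hg refl) (^-homo h g x))

  ∙≈∙⇒^≈ : ∀ {g h} x → g ∙ x ≈ x ∙ h → g ^ x ≈ h
  ∙≈∙⇒^≈ {g} {h} x gx≈xh = begin
    x ⁻¹ ∙ g ∙ x    ≈⟨ assoc (x ⁻¹) g x ⟩
    x ⁻¹ ∙ (g ∙ x)  ≈⟨ ∙-congˡ gx≈xh ⟩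
    x ⁻¹ ∙ (x ∙ h)  ≈⟨ \\-leftDividesʳ x h ⟩
    h               ∎

  Commute⇒^≈ : ∀ {g x} → Commute g x → g ^ x ≈ g
  Commute⇒^≈ {g} {x} = ∙≈∙⇒^≈ x

  ^≈⇒Commute : ∀ {g x} → g ^ x ≈ g → Commute g x
  ^≈⇒Commute {g} {x} g^x≈g = begin
    g ∙ x                ≈⟨ \\-leftDividesˡ x (g ∙ x) ⟨
    x ∙ (x ⁻¹ ∙ (g ∙ x))  ≈⟨ ∙-congˡ (trans (sym (assoc (x ⁻¹) g x)) g^x≈g) ⟩
    x ∙ g                ∎

  Commute-sym : ∀ {x y} → Commute x y → Commute y x
  Commute-sym = sym

  Commute-ε : ∀ x → Commute x ε
  Commute-ε x = trans (identityʳ x) (sym (identityˡ x))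

  Commute-∙ : ∀ {x y z} → Commute x y → Commute x z → Commute x (y ∙ z)
  Commute-∙ {x} {y} {z} xy≈yx xz≈zx = ^≈⇒Commute (begin
    x ^ (y ∙ z)  ≈⟨ ^-^ x y z ⟨
    x ^ y ^ z    ≈⟨ ^-cong (Commute⇒^≈ xy≈yx) refl ⟩
    x ^ z        ≈⟨ Commute⇒^≈ xz≈zx ⟩
    x            ∎)

  Commute-⁻¹ : ∀ {x y} → Commute x y → Commute x (y ⁻¹)
  Commute-⁻¹ {x} {y} xy≈yx = ^≈⇒Commute (begin
    x ^ (y ⁻¹)      ≈⟨ ^-cong (Commute⇒^≈ xy≈yx) refl ⟨
    x ^ y ^ (y ⁻¹)  ≈⟨ ^-^⁻¹ x y ⟩
    x               ∎)

  Commute-resp : ∀ {x x′ y y′} → x ≈ x′ → y ≈ y′ → Commute x y → Commute x′ y′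
  Commute-resp x≈x′ y≈y′ xy≈yx =
    trans (∙-cong (sym x≈x′) (sym y≈y′)) (trans xy≈yx (∙-cong y≈y′ x≈x′))

  ^-Commute⁻¹ : ∀ {g h} x → Commute (g ^ x) (h ^ x) → Commute g h
  ^-Commute⁻¹ {g} {h} x gˣ⇄hˣ = Commute-resp (^-^⁻¹ g x) (^-^⁻¹ h x) (^-Commute (x ⁻¹) gˣ⇄hˣ)

  [,]-cong : ∀ {x x′ y y′} → x ≈ x′ → y ≈ y′ → [ x , y ] ≈ [ x′ , y′ ]
  [,]-cong x≈x′ y≈y′ = ∙-cong (∙-cong (∙-cong (⁻¹-cong x≈x′) (⁻¹-cong y≈y′)) x≈x′) y≈y′

  [,]≈⁻¹∙^ : ∀ x y → [ x , y ] ≈ x ⁻¹ ∙ x ^ y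
  [,]≈⁻¹∙^ x y = solve monoid

  Commute⇒[,]≈ε : ∀ {x y} → Commute x y → [ x , y ] ≈ ε
  Commute⇒[,]≈ε {x} {y} xy≈yx =
    trans ([,]≈⁻¹∙^ x y) (trans (∙-congˡ (Commute⇒^≈ xy≈yx)) (inverseˡ x))

  [,]≈ε⇒Commute : ∀ {x y} → [ x , y ] ≈ ε → Commute x y
  [,]≈ε⇒Commute {x} {y} [x,y]≈ε = ^≈⇒Commute (∙-cancelˡ (x ⁻¹) (x ^ y) x
    (trans (sym ([,]≈⁻¹∙^ x y)) (trans [x,y]≈ε (sym (inverseˡ x)))))

  -- [ x , y ] unfolds definitionally to y ⁻¹ ^ x ∙ y; this form is used without comment below.
  [,]-swap : ∀ x y → [ y , x ] ≈ [ x , y ] ⁻¹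
  [,]-swap x y = begin
    [ y , x ]              ≈⟨ [,]≈⁻¹∙^ y x ⟩
    y ⁻¹ ∙ y ^ x           ≈⟨ ∙-congˡ (^-cong (⁻¹-involutive y) refl) ⟨
    y ⁻¹ ∙ y ⁻¹ ⁻¹ ^ x     ≈⟨ ∙-congˡ (⁻¹-^ (y ⁻¹) x) ⟩
    y ⁻¹ ∙ (y ⁻¹ ^ x) ⁻¹   ≈⟨ ⁻¹-anti-homo-∙ (y ⁻¹ ^ x) y ⟨
    (y ⁻¹ ^ x ∙ y) ⁻¹      ∎

  [,]-∙ʳ : ∀ x y z → [ x , y ∙ z ] ≈ [ x , z ] ∙ [ x , y ] ^ z
  [,]-∙ʳ x y z = sym (begin
    [ x , z ] ∙ [ x , y ] ^ z                ≈⟨ ∙-cong ([,]≈⁻¹∙^ x z) (^-cong ([,]≈⁻¹∙^ x y) refl) ⟩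
    x ⁻¹ ∙ x ^ z ∙ (x ⁻¹ ∙ x ^ y) ^ z        ≈⟨ ∙-congˡ (^-homo (x ⁻¹) (x ^ y) z) ⟩
    x ⁻¹ ∙ x ^ z ∙ (x ⁻¹ ^ z ∙ x ^ y ^ z)    ≈⟨ ∙-congˡ (∙-cong (⁻¹-^ x z) (^-^ x y z)) ⟩
    x ⁻¹ ∙ x ^ z ∙ ((x ^ z) ⁻¹ ∙ x ^ (y ∙ z))  ≈⟨ assoc (x ⁻¹) (x ^ z) _ ⟩
    x ⁻¹ ∙ (x ^ z ∙ ((x ^ z) ⁻¹ ∙ x ^ (y ∙ z)))  ≈⟨ ∙-congˡ (\\-leftDividesˡ (x ^ z) (x ^ (y ∙ z))) ⟩
    x ⁻¹ ∙ x ^ (y ∙ z)                       ≈⟨ [,]≈⁻¹∙^ x (y ∙ z) ⟨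
    [ x , y ∙ z ]                            ∎)

  [,]-⁻¹ʳ : ∀ x y → [ x , y ⁻¹ ] ≈ [ y , x ] ^ (y ⁻¹)
  [,]-⁻¹ʳ x y = sym (begin
    (x ⁻¹ ^ y ∙ x) ^ (y ⁻¹)              ≈⟨ ^-homo (x ⁻¹ ^ y) x (y ⁻¹) ⟩
    x ⁻¹ ^ y ^ (y ⁻¹) ∙ x ^ (y ⁻¹)       ≈⟨ ∙-congʳ (^-^⁻¹ (x ⁻¹) y) ⟩
    x ⁻¹ ∙ x ^ (y ⁻¹)                    ≈⟨ [,]≈⁻¹∙^ x (y ⁻¹) ⟨
    [ x , y ⁻¹ ]                         ∎)

  record IsSubgroup {p} (N : Carrier → Set p) : Set (c ⊔ ℓ ⊔ p) where
    field
      ∈-resp : ∀ {x y} → x ≈ y → N x → N y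
      ε∈     : N ε
      ∙∈     : ∀ {x y} → N x → N y → N (x ∙ y)
      ⁻¹∈    : ∀ {x} → N x → N (x ⁻¹)

    pow∈ : ∀ {x} n → N x → N (pow x n)
    pow∈ zero    x∈N = ε∈
    pow∈ (suc n) x∈N = ∙∈ (pow∈ n x∈N) x∈N

  open IsSubgroup public

  closure-isSubgroup : ∀ {P} → IsSubgroup (Closure P)
  closure-isSubgroup = record { ∈-resp = resp ; ε∈ = one ; ∙∈ = mul ; ⁻¹∈ = inv }

  closure-least : ∀ {p} {P} {N : Carrier → Set p} → IsSubgroup N →
                  (∀ {z} → P z → N z) → ∀ {x} → Closure P x → N x
  closure-least N P⊆N (inc z∈P)   = P⊆N z∈P
  closure-least N P⊆N one         = ε∈ N
  closure-least N P⊆N (mul x∈ y∈) = ∙∈ N (closure-least N P⊆N x∈) (closure-least N P⊆N y∈)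
  closure-least N P⊆N (inv x∈)    = ⁻¹∈ N (closure-least N P⊆N x∈)
  closure-least N P⊆N (resp e x∈) = ∈-resp N e (closure-least N P⊆N x∈)

  trivial-isSubgroup : IsSubgroup (_≈ ε)
  trivial-isSubgroup = record
    { ∈-resp = λ x≈y x≈ε → trans (sym x≈y) x≈ε
    ; ε∈     = refl
    ; ∙∈     = λ x≈ε y≈ε → trans (∙-cong x≈ε y≈ε) (identityʳ ε)
    ; ⁻¹∈    = λ x≈ε → trans (⁻¹-cong x≈ε) ε⁻¹≈ε
    }

  commutant-isSubgroup : ∀ x → IsSubgroup (Commute x)
  commutant-isSubgroup x = record
    { ∈-resp = λ e → Commute-resp refl e ; ε∈ = Commute-ε x ; ∙∈ = Commute-∙ ; ⁻¹∈ = Commute-⁻¹ }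

  Centralizer : ∀ {p} → (Carrier → Set p) → Carrier → Set (c ⊔ ℓ ⊔ p)
  Centralizer P z = ∀ {h} → P h → Commute h z

  centralizer-isSubgroup : ∀ {p} (P : Carrier → Set p) → IsSubgroup (Centralizer P)
  centralizer-isSubgroup P = record
    { ∈-resp = λ e z∈C h∈P → Commute-resp refl e (z∈C h∈P)
    ; ε∈     = λ {h} _ → Commute-ε h
    ; ∙∈     = λ y∈C z∈C h∈P → Commute-∙ (y∈C h∈P) (z∈C h∈P)
    ; ⁻¹∈    = λ z∈C h∈P → Commute-⁻¹ (z∈C h∈P)
    }

  centralizer-closure : ∀ {P z} → Centralizer P z → Centralizer (Closure P) z
  centralizer-closure z∈C h∈⟨P⟩ =
    Commute-sym (closure-least (commutant-isSubgroup _) (λ h∈P → Commute-sym (z∈C h∈P)) h∈⟨P⟩)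

  closure-abelian : ∀ {P} → (∀ {y z} → P y → P z → Commute y z) → IsAbelian (Closure P)
  closure-abelian {P} P-abelian y z y∈ z∈ = centralizer-closure {P} {z} z-centralizes-P y∈
    where
    z-centralizes-P : Centralizer P z
    z-centralizes-P h∈P = Commute-sym (centralizer-closure {P} (λ h′∈P → P-abelian h′∈P h∈P) z∈)

  preimage-isSubgroup : ∀ {p} {N : Carrier → Set p} → IsSubgroup N → ∀ x → IsSubgroup (λ g → N (g ^ x))
  preimage-isSubgroup N x = record
    { ∈-resp = λ g≈h → ∈-resp N (^-cong g≈h refl)
    ; ε∈     = ∈-resp N (sym (ε^ x)) (ε∈ N)
    ; ∙∈     = λ gˣ∈N hˣ∈N → ∈-resp N (sym (^-homo _ _ x)) (∙∈ N gˣ∈N hˣ∈N)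
    ; ⁻¹∈    = λ gˣ∈N → ∈-resp N (sym (⁻¹-^ _ x)) (⁻¹∈ N gˣ∈N)
    }

  Normalizer : ∀ {p} → (Carrier → Set p) → Carrier → Set (c ⊔ p)
  Normalizer N x = (∀ {g} → N g → N (g ^ x)) × (∀ {g} → N g → N (g ^ (x ⁻¹)))

  normalizer-isSubgroup : ∀ {p} {N : Carrier → Set p} →
                          (∀ {x y} → x ≈ y → N x → N y) → IsSubgroup (Normalizer N)
  normalizer-isSubgroup {N = N} N-resp = record
    { ∈-resp = λ x≈y (by-x , by-x⁻¹) →
                 (λ g∈N → N-resp (^-cong refl x≈y) (by-x g∈N))
               , (λ g∈N → N-resp (^-cong refl (⁻¹-cong x≈y)) (by-x⁻¹ g∈N))
    ; ε∈     = (λ g∈N → N-resp (sym (^ε _)) g∈N)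
             , (λ g∈N → N-resp (trans (sym (^ε _)) (^-cong refl (sym ε⁻¹≈ε))) g∈N)
    ; ∙∈     = λ {x} {y} (by-x , by-x⁻¹) (by-y , by-y⁻¹) →
                 (λ g∈N → N-resp (^-^ _ x y) (by-y (by-x g∈N)))
               , (λ g∈N → N-resp (trans (^-^ _ (y ⁻¹) (x ⁻¹)) (^-cong refl (sym (⁻¹-anti-homo-∙ x y))))
                                 (by-x⁻¹ (by-y⁻¹ g∈N)))
    ; ⁻¹∈    = λ {x} (by-x , by-x⁻¹) →
                 by-x⁻¹ , (λ g∈N → N-resp (^-cong refl (sym (⁻¹-involutive x))) (by-x g∈N))
    }

  commutators-∈ : ∀ {p P} {N : Carrier → Set p} → IsSubgroup N →
                  (∀ {x g} → Closure P x → N g → N (g ^ x)) →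
                  (∀ {g h} → P g → P h → N [ g , h ]) →
                  ∀ {x y} → Closure P x → Closure P y → N [ x , y ]
  commutators-∈ {P = P} {N} N-sub conj gens x∈ y∈ =
    right (λ h∈P → swap (right (gens h∈P) x∈)) y∈
    where
    swap : ∀ {x y} → N [ x , y ] → N [ y , x ]
    swap {x} {y} [x,y]∈N = ∈-resp N-sub (sym ([,]-swap x y)) (⁻¹∈ N-sub [x,y]∈N)

    right : ∀ {x} → (∀ {h} → P h → N [ x , h ]) → ∀ {y} → Closure P y → N [ x , y ]
    right x-gens (inc h∈P)       = x-gens h∈P
    right x-gens one             = ∈-resp N-sub (sym (Commute⇒[,]≈ε (Commute-ε _))) (ε∈ N-sub)
    right x-gens (mul {y} {z} y∈ z∈) =
      ∈-resp N-sub (sym ([,]-∙ʳ _ y z)) (∙∈ N-sub (right x-gens z∈) (conj z∈ (right x-gens y∈)))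
    right x-gens (inv {y} y∈)    =
      ∈-resp N-sub (sym ([,]-⁻¹ʳ _ y)) (conj (inv y∈) (swap (right x-gens y∈)))
    right x-gens (resp y≈y′ y∈)  = ∈-resp N-sub ([,]-cong refl y≈y′) (right x-gens y∈)

  commSub-least : ∀ {p} {K L} {N : Carrier → Set p} → IsSubgroup N →
                  (∀ {x y} → K x → L y → N [ x , y ]) → ∀ {z} → CommSub K L z → N z
  commSub-least N [K,L]⊆N = closure-least N λ { (x , y , x∈K , y∈L , z≈[x,y]) →
    ∈-resp N (sym z≈[x,y]) ([K,L]⊆N x∈K y∈L) }

  pow-cong : ∀ {x y} n → x ≈ y → pow x n ≈ pow y n
  pow-cong zero    x≈y = refl
  pow-cong (suc n) x≈y = ∙-cong (pow-cong n x≈y) x≈y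

  pow-ε : ∀ n → pow ε n ≈ ε
  pow-ε n = pow∈ trivial-isSubgroup n refl

  Commute-pow : ∀ {x y} n → Commute x y → Commute x (pow y n)
  Commute-pow {x} n = pow∈ (commutant-isSubgroup x) n

  Commute-pow-pow : ∀ x m n → Commute (pow x m) (pow x n)
  Commute-pow-pow x m n = Commute-pow n (Commute-sym (Commute-pow m refl))

  ^-pow-suc : ∀ g x n → g ^ pow x (suc n) ≈ g ^ x ^ pow x n
  ^-pow-suc g x n = trans (^-cong refl (sym (Commute-pow n refl))) (sym (^-^ g x (pow x n)))

  pow-+ : ∀ x m n → pow x (m + n) ≈ pow x m ∙ pow x n
  pow-+ x m zero    rewrite +-identityʳ m = sym (identityʳ (pow x m))
  pow-+ x m (suc n) rewrite +-suc m n     = trans (∙-congʳ (pow-+ x m n)) (assoc _ _ _)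

  pow-* : ∀ x m n → pow x (m * n) ≈ pow (pow x m) n
  pow-* x m zero    rewrite *-zeroʳ m = refl
  pow-* x m (suc n) rewrite *-suc m n | +-comm m (m * n) =
    trans (pow-+ x (m * n) m) (∙-congʳ (pow-* x m n))

  -- powDiff x m n stands for x^(m − n): Defs provides natural powers only.
  powDiff : Carrier → ℕ → ℕ → Carrier
  powDiff x m n = pow x m ∙ pow x n ⁻¹

  pow∙powDiff : ∀ x m n → pow x n ∙ powDiff x m n ≈ pow x m
  pow∙powDiff x m n = begin
    pow x n ∙ (pow x m ∙ pow x n ⁻¹)  ≈⟨ assoc (pow x n) (pow x m) _ ⟨
    pow x n ∙ pow x m ∙ pow x n ⁻¹    ≈⟨ ∙-congʳ (Commute-pow-pow x n m) ⟩
    pow x m ∙ pow x n ∙ pow x n ⁻¹    ≈⟨ //-rightDividesʳ (pow x n) (pow x m) ⟩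
    pow x m                           ∎

  powDiff-+ : ∀ x m n → powDiff x (m + n) n ≈ pow x m
  powDiff-+ x m n = trans (∙-congʳ (pow-+ x m n)) (//-rightDividesʳ (pow x n) (pow x m))

  powDiff-∙ : ∀ x m n m′ n′ → powDiff x m n ∙ powDiff x m′ n′ ≈ powDiff x (m + m′) (n + n′)
  powDiff-∙ x m n m′ n′ = begin
    pow x m ∙ pow x n ⁻¹ ∙ (pow x m′ ∙ pow x n′ ⁻¹)    ≈⟨ solve monoid ⟩
    pow x m ∙ (pow x n ⁻¹ ∙ pow x m′) ∙ pow x n′ ⁻¹    ≈⟨ ∙-congʳ (∙-congˡ (Commute-⁻¹ (Commute-pow-pow x m′ n))) ⟨
    pow x m ∙ (pow x m′ ∙ pow x n ⁻¹) ∙ pow x n′ ⁻¹    ≈⟨ solve monoid ⟩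
    pow x m ∙ pow x m′ ∙ (pow x n ⁻¹ ∙ pow x n′ ⁻¹)    ≈⟨ ∙-congˡ (⁻¹-anti-homo-∙ (pow x n′) (pow x n)) ⟨
    pow x m ∙ pow x m′ ∙ (pow x n′ ∙ pow x n) ⁻¹       ≈⟨ ∙-congˡ (⁻¹-cong (Commute-pow-pow x n′ n)) ⟩
    pow x m ∙ pow x m′ ∙ (pow x n ∙ pow x n′) ⁻¹       ≈⟨ ∙-cong (pow-+ x m m′) (⁻¹-cong (pow-+ x n n′)) ⟨
    powDiff x (m + m′) (n + n′)                        ∎

  powDiff-⁻¹ : ∀ x m n → powDiff x m n ⁻¹ ≈ powDiff x n m
  powDiff-⁻¹ x m n = trans (⁻¹-anti-homo-∙ (pow x m) (pow x n ⁻¹)) (∙-congʳ (⁻¹-involutive (pow x n)))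

  pow-powDiff : ∀ x m n k → pow (powDiff x m n) k ≈ powDiff x (k * m) (k * n)
  pow-powDiff x m n zero    = sym (inverseʳ ε)
  pow-powDiff x m n (suc k) = begin
    pow (powDiff x m n) k ∙ powDiff x m n     ≈⟨ ∙-congʳ (pow-powDiff x m n k) ⟩
    powDiff x (k * m) (k * n) ∙ powDiff x m n ≈⟨ powDiff-∙ x (k * m) (k * n) m n ⟩
    powDiff x (k * m + m) (k * n + n)         ≡⟨ ≡.cong₂ (powDiff x) (+-comm (k * m) m) (+-comm (k * n) n) ⟩
    powDiff x (suc k * m) (suc k * n)         ∎

module OrderedGroupTheory {c ℓ ℓ₂} (OG : OrderedGroup c ℓ ℓ₂) where
  open OrderedGroup OG renaming (_≤_ to _≼_)
  open GroupNotions group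
  open GroupTheory group
  open import Algebra.Properties.Group group using (∙-cancelʳ; ∙-cancelˡ; x∙y⁻¹≈ε⇒x≈y)
  open import Relation.Binary.Reasoning.Setoid setoid
  open IsTotalOrder isTotalOrder using (total; antisym; ≲-respˡ-≈; ≲-respʳ-≈)
    renaming (trans to ≼-trans; reflexive to ≼-reflexive)

  ∙-monoʳ-≼ : ∀ {x y} z → x ≼ y → (z ∙ x) ≼ (z ∙ y)
  ∙-monoʳ-≼ z x≼y = ≲-respʳ-≈ (identityʳ _) (≲-respˡ-≈ (identityʳ _) (compat z ε x≼y))

  ∙-monoˡ-≼ : ∀ {x y} z → x ≼ y → (x ∙ z) ≼ (y ∙ z)
  ∙-monoˡ-≼ z x≼y = ≲-respʳ-≈ (∙-congʳ (identityˡ _)) (≲-respˡ-≈ (∙-congʳ (identityˡ _)) (compat ε z x≼y))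

  pow-mono-≼ : ∀ {x y} n → x ≼ y → pow x n ≼ pow y n
  pow-mono-≼ zero    x≼y = ≼-reflexive refl
  pow-mono-≼ (suc n) x≼y = ≼-trans (∙-monoʳ-≼ _ x≼y) (∙-monoˡ-≼ _ (pow-mono-≼ n x≼y))

  pow-suc-injective-≼ : ∀ {x y} n → x ≼ y → pow x (suc n) ≈ pow y (suc n) → x ≈ y
  pow-suc-injective-≼ {x} {y} n x≼y xⁿ⁺¹≈yⁿ⁺¹ = ∙-cancelˡ (pow x n) x y (antisym
    (∙-monoʳ-≼ (pow x n) x≼y)
    (≲-respʳ-≈ (sym xⁿ⁺¹≈yⁿ⁺¹) (∙-monoˡ-≼ y (pow-mono-≼ n x≼y))))

  pow-suc-injective : ∀ {x y} n → pow x (suc n) ≈ pow y (suc n) → x ≈ y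
  pow-suc-injective {x} {y} n xⁿ⁺¹≈yⁿ⁺¹ with total x y
  ... | inj₁ x≼y = pow-suc-injective-≼ n x≼y xⁿ⁺¹≈yⁿ⁺¹
  ... | inj₂ y≼x = sym (pow-suc-injective-≼ n y≼x (sym xⁿ⁺¹≈yⁿ⁺¹))

  Commute-pow-suc : ∀ {x y} n → Commute (pow x (suc n)) y → Commute x y
  Commute-pow-suc {x} {y} n xⁿ⁺¹y≈yxⁿ⁺¹ = ^≈⇒Commute (pow-suc-injective n (begin
    pow (x ^ y) (suc n)  ≈⟨ pow-^ x y (suc n) ⟨
    pow x (suc n) ^ y    ≈⟨ Commute⇒^≈ xⁿ⁺¹y≈yxⁿ⁺¹ ⟩
    pow x (suc n)        ∎))

  pow-injective : ∀ {x} → ¬ x ≈ ε → ∀ m n → pow x m ≈ pow x n → m ≡ n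
  pow-injective x≉ε zero    zero    _ = ≡.refl
  pow-injective x≉ε zero    (suc n) ε≈xⁿ⁺¹ =
    ⊥-elim (x≉ε (pow-suc-injective n (trans (sym ε≈xⁿ⁺¹) (sym (pow-ε (suc n))))))
  pow-injective x≉ε (suc m) zero    xᵐ⁺¹≈ε =
    ⊥-elim (x≉ε (pow-suc-injective m (trans xᵐ⁺¹≈ε (sym (pow-ε (suc m))))))
  pow-injective x≉ε (suc m) (suc n) xᵐ⁺¹≈xⁿ⁺¹ = ≡.cong suc (pow-injective x≉ε m n (∙-cancelʳ _ _ _ xᵐ⁺¹≈xⁿ⁺¹))

  powDiff≈ε⇒≡ : ∀ {x} → ¬ x ≈ ε → ∀ m n → powDiff x m n ≈ ε → m ≡ n
  powDiff≈ε⇒≡ x≉ε m n xᵐ⁻ⁿ≈ε = pow-injective x≉ε m n (x∙y⁻¹≈ε⇒x≈y _ _ xᵐ⁻ⁿ≈ε)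

  centralizer-root : ∀ {p} {P : Carrier → Set p} {x} n → Centralizer P (pow x (suc n)) → Centralizer P x
  centralizer-root n xⁿ⁺¹∈C h∈P = Commute-sym (Commute-pow-suc n (Commute-sym (xⁿ⁺¹∈C h∈P)))

m*x+n*y≡m*y+n*x⇒m≡n⊎x≡y : ∀ m n x y → m * x + n * y ≡ m * y + n * x → m ≡ n ⊎ x ≡ y
m*x+n*y≡m*y+n*x⇒m≡n⊎x≡y zero    zero    x y _ = inj₁ ≡.refl
m*x+n*y≡m*y+n*x⇒m≡n⊎x≡y zero    (suc n) x y e = inj₂ (≡.sym (*-cancelˡ-≡ y x (suc n) e))
m*x+n*y≡m*y+n*x⇒m≡n⊎x≡y (suc m) zero    x y e =
  inj₂ (*-cancelˡ-≡ x y (suc m) (≡.trans (≡.sym (+-identityʳ _)) (≡.trans e (+-identityʳ _))))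
m*x+n*y≡m*y+n*x⇒m≡n⊎x≡y (suc m) (suc n) x y e
  with m*x+n*y≡m*y+n*x⇒m≡n⊎x≡y m n x y
         (+-cancelˡ-≡ (x + y) _ _ (≡.trans (split x y m n) (≡.trans e (≡.sym (split′ x y m n)))))
  where
  split : ∀ x y m n → (x + y) + (m * x + n * y) ≡ suc m * x + suc n * y
  split = solve-∀
  split′ : ∀ x y m n → (x + y) + (m * y + n * x) ≡ suc m * y + suc n * x
  split′ = solve-∀
... | inj₁ m≡n = inj₁ (≡.cong suc m≡n)
... | inj₂ x≡y = inj₂ x≡y

module TranslateRelations {c ℓ ℓ₂} (OG : OrderedGroup c ℓ ℓ₂) where
  open OrderedGroup OG hiding (_≤_)
  open GroupNotions group
  open GroupTheory group
  open OrderedGroupTheory OG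
  open import Algebra.Properties.Group group using (∙-cancelˡ; x≈z//y; \\-leftDividesʳ)
  open import Relation.Binary.Reasoning.Setoid setoid

  module _ (a b d : Carrier) (a⇄d : Commute a d) (k q j l : ℕ)
           (rel₁ : (a ∙ pow d k) ^ b ≈ a ∙ pow d l)
           (rel₂ : (a ∙ pow d (k + suc q)) ^ b ≈ a ∙ pow d j) where

    p : ℕ
    p = suc q

    dᵖ^b : pow d p ^ b ≈ powDiff d j l
    dᵖ^b = ∙-cancelˡ (a ∙ pow d l) _ _ (begin
      a ∙ pow d l ∙ pow d p ^ b                  ≈⟨ ∙-congʳ rel₁ ⟨
      (a ∙ pow d k) ^ b ∙ pow d p ^ b            ≈⟨ ^-homo (a ∙ pow d k) (pow d p) b ⟨
      (a ∙ pow d k ∙ pow d p) ^ b                ≈⟨ ^-cong (trans (∙-congˡ (pow-+ d k p)) (sym (assoc a _ _))) refl ⟨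
      (a ∙ pow d (k + p)) ^ b                    ≈⟨ rel₂ ⟩
      a ∙ pow d j                                ≈⟨ ∙-congˡ (pow∙powDiff d j l) ⟨
      a ∙ (pow d l ∙ powDiff d j l)              ≈⟨ assoc a _ _ ⟨
      a ∙ pow d l ∙ powDiff d j l                ∎)

    a^b : a ^ b ≈ a ∙ pow d l ∙ (pow d k ^ b) ⁻¹
    a^b = x≈z//y _ _ _ (trans (sym (^-homo a (pow d k) b)) rel₁)

    A∪D : Carrier → Set ℓ
    A∪D g = g ≈ a ⊎ g ≈ d

    C : Carrier → Set (c ⊔ ℓ)
    C = Centralizer A∪D

    C-sub : IsSubgroup C
    C-sub = centralizer-isSubgroup A∪D

    a∈C : C a
    a∈C (inj₁ h≈a) = Commute-resp (sym h≈a) refl refl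
    a∈C (inj₂ h≈d) = Commute-resp (sym h≈d) refl (Commute-sym a⇄d)

    d∈C : C d
    d∈C (inj₁ h≈a) = Commute-resp (sym h≈a) refl a⇄d
    d∈C (inj₂ h≈d) = Commute-resp (sym h≈d) refl refl

    conjugates-centralize : ∀ n → C (a ^ pow b n) × C (d ^ pow b n)
    conjugates-centralize zero    = ∈-resp C-sub (sym (^ε a)) a∈C , ∈-resp C-sub (sym (^ε d)) d∈C
    conjugates-centralize (suc n) = a-part , d-part
      where
      Sₙ : IsSubgroup (λ g → C (g ^ pow b n))
      Sₙ₊₁ : IsSubgroup (λ g → C (g ^ pow b (suc n)))
      Sₙ   = preimage-isSubgroup C-sub (pow b n)
      Sₙ₊₁ = preimage-isSubgroup C-sub (pow b (suc n))
      from-b : ∀ {g} → C (g ^ b ^ pow b n) → C (g ^ pow b (suc n))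
      from-b = ∈-resp C-sub (sym (^-pow-suc _ b n))
      aᵇⁿ∈C : C (a ^ pow b n)
      aᵇⁿ∈C = proj₁ (conjugates-centralize n)
      dᵇⁿ∈C : C (d ^ pow b n)
      dᵇⁿ∈C = proj₂ (conjugates-centralize n)
      d-part : C (d ^ pow b (suc n))
      d-part = centralizer-root q (∈-resp C-sub (pow-^ d (pow b (suc n)) p)
        (from-b (∈-resp Sₙ (sym dᵖ^b) (∙∈ Sₙ (pow∈ Sₙ j dᵇⁿ∈C) (⁻¹∈ Sₙ (pow∈ Sₙ l dᵇⁿ∈C))))))
      a-part : C (a ^ pow b (suc n))
      a-part = from-b (∈-resp Sₙ (sym a^b) (∙∈ Sₙ (∙∈ Sₙ aᵇⁿ∈C (pow∈ Sₙ l dᵇⁿ∈C))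
        (⁻¹∈ Sₙ (∈-resp C-sub (^-pow-suc _ b n) (pow∈ Sₙ₊₁ k d-part)))))

    conjugate-centralizes : ∀ {g} n → A∪D g → C (g ^ pow b n)
    conjugate-centralizes n (inj₁ g≈a) =
      ∈-resp C-sub (^-cong (sym g≈a) refl) (proj₁ (conjugates-centralize n))
    conjugate-centralizes n (inj₂ g≈d) =
      ∈-resp C-sub (^-cong (sym g≈d) refl) (proj₂ (conjugates-centralize n))

    conjugates-commute-+ : ∀ {g h} m r → A∪D g → A∪D h → Commute (g ^ pow b m) (h ^ pow b (m + r))
    conjugates-commute-+ {g} {h} m r g∈ h∈ = Commute-resp refl (begin
      h ^ pow b r ^ pow b m          ≈⟨ ^-^ h (pow b r) (pow b m) ⟩
      h ^ (pow b r ∙ pow b m)        ≈⟨ ^-cong refl (pow-+ b r m) ⟨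
      h ^ pow b (r + m)              ≡⟨ ≡.cong (λ e → h ^ pow b e) (+-comm r m) ⟩
      h ^ pow b (m + r)              ∎)
      (^-Commute (pow b m) (conjugate-centralizes r h∈ g∈))

    conjugates-commute : ∀ {g h} m n → A∪D g → A∪D h → Commute (g ^ pow b m) (h ^ pow b n)
    conjugates-commute m n g∈ h∈ with ≤-total m n
    ... | inj₁ m≤n with m≤n⇒∃[o]m+o≡n m≤n
    ...   | r , ≡.refl = conjugates-commute-+ m r g∈ h∈
    conjugates-commute m n g∈ h∈ | inj₂ n≤m with m≤n⇒∃[o]m+o≡n n≤m
    ...   | r , ≡.refl = Commute-sym (conjugates-commute-+ n r h∈ g∈)

    V : Carrier → Set (c ⊔ ℓ)
    V z = Σ Carrier λ g → Σ ℕ λ m → A∪D g × z ≈ g ^ pow b m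

    V-resp : ∀ {y z} → y ≈ z → V y → V z
    V-resp y≈z (g , m , g∈ , y≈) = g , m , g∈ , trans (sym y≈z) y≈

    V-commute : ∀ {y z} → V y → V z → Commute y z
    V-commute (g , m , g∈ , y≈) (h , n , h∈ , z≈) =
      Commute-resp (sym y≈) (sym z≈) (conjugates-commute m n g∈ h∈)

    V-^b : ∀ {z} → V z → V (z ^ b)
    V-^b (g , m , g∈ , z≈) = g , suc m , g∈ , trans (^-cong z≈ refl) (^-^ g (pow b m) b)

    V-^pow : ∀ {z} n → V z → V (z ^ pow b n)
    V-^pow {z} n (g , m , g∈ , z≈) = g , m + n , g∈ , (begin
      z ^ pow b n                ≈⟨ ^-cong z≈ refl ⟩
      g ^ pow b m ^ pow b n      ≈⟨ ^-^ g (pow b m) (pow b n) ⟩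
      g ^ (pow b m ∙ pow b n)    ≈⟨ ^-cong refl (pow-+ b m n) ⟨
      g ^ pow b (m + n)          ∎)

    -- The conjugates of a and d by arbitrary integer powers of b.
    W : Carrier → Set (c ⊔ ℓ)
    W x = Σ ℕ λ n → V (x ^ pow b n)

    W-commute : ∀ {x y} → W x → W y → Commute x y
    W-commute {x} {y} (m , xᵐ∈V) (n , yⁿ∈V) = ^-Commute⁻¹ (pow b m ∙ pow b n)
      (Commute-resp (^-^ x (pow b m) (pow b n))
                    (trans (^-^ y (pow b n) (pow b m)) (^-cong refl (Commute-pow-pow b n m)))
                    (V-commute (V-^pow n xᵐ∈V) (V-^pow m yⁿ∈V)))

    W-^b : ∀ {x} → W x → W (x ^ b)
    W-^b {x} (n , xⁿ∈V) = n , V-resp (trans (^-^ x (pow b n) b) (^-pow-suc x b n)) (V-^b xⁿ∈V)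

    W-^b⁻¹ : ∀ {x} → W x → W (x ^ (b ⁻¹))
    W-^b⁻¹ {x} (n , xⁿ∈V) =
      suc n , V-resp (sym (trans (^-pow-suc (x ^ (b ⁻¹)) b n) (^-cong (^⁻¹-^ x b) refl))) xⁿ∈V

    N : Carrier → Set (c ⊔ ℓ)
    N = Closure W

    N-abelian : IsAbelian N
    N-abelian = closure-abelian W-commute

    a∈N : N a
    a∈N = inc (0 , a , 0 , inj₁ refl , refl)

    d∈N : N d
    d∈N = inc (0 , d , 0 , inj₂ refl , refl)

    N-^b : ∀ {x} → N x → N (x ^ b)
    N-^b = closure-least (preimage-isSubgroup closure-isSubgroup b) (λ x∈W → inc (W-^b x∈W))

    N-^b⁻¹ : ∀ {x} → N x → N (x ^ (b ⁻¹))
    N-^b⁻¹ = closure-least (preimage-isSubgroup closure-isSubgroup (b ⁻¹)) (λ x∈W → inc (W-^b⁻¹ x∈W))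

    Generator : Carrier → Set (c ⊔ ℓ)
    Generator z = Level.Lift (c ⊔ ℓ) (z ≈ a ⊎ (z ≈ b ⊎ z ≈ d))

    H : Carrier → Set (c ⊔ ℓ)
    H = Gen3 a b d

    generator-∈N-or-≈b : ∀ {g} → Generator g → N g ⊎ g ≈ b
    generator-∈N-or-≈b (lift (inj₁ g≈a))        = inj₁ (resp (sym g≈a) a∈N)
    generator-∈N-or-≈b (lift (inj₂ (inj₁ g≈b))) = inj₂ g≈b
    generator-∈N-or-≈b (lift (inj₂ (inj₂ g≈d))) = inj₁ (resp (sym g≈d) d∈N)

    N-normalizes-N : ∀ {x} → N x → Normalizer N x
    N-normalizes-N x∈N =
        (λ g∈N → resp (sym (Commute⇒^≈ (N-abelian _ _ g∈N x∈N))) g∈N)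
      , (λ g∈N → resp (sym (Commute⇒^≈ (N-abelian _ _ g∈N (inv x∈N)))) g∈N)

    H-normalizes-N : ∀ {x g} → H x → N g → N (g ^ x)
    H-normalizes-N x∈H = proj₁ (closure-least (normalizer-isSubgroup resp) generator-normalizes x∈H)
      where
      generator-normalizes : ∀ {x} → Generator x → Normalizer N x
      generator-normalizes x-gen with generator-∈N-or-≈b x-gen
      ... | inj₁ x∈N = N-normalizes-N x∈N
      ... | inj₂ x≈b = (λ g∈N → resp (^-cong refl (sym x≈b)) (N-^b g∈N))
                     , (λ g∈N → resp (^-cong refl (⁻¹-cong (sym x≈b))) (N-^b⁻¹ g∈N))

    generator-commutators-∈N : ∀ {g h} → Generator g → Generator h → N [ g , h ]
    generator-commutators-∈N {g} {h} g-gen h-gen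
      with generator-∈N-or-≈b g-gen | generator-∈N-or-≈b h-gen
    ... | inj₁ g∈N | _       = resp (sym ([,]≈⁻¹∙^ g h)) (mul (inv g∈N) (H-normalizes-N (inc h-gen) g∈N))
    ... | inj₂ _   | inj₁ h∈N = mul (H-normalizes-N (inc g-gen) (inv h∈N)) h∈N
    ... | inj₂ g≈b | inj₂ h≈b = resp (sym (Commute⇒[,]≈ε (Commute-resp (sym g≈b) (sym h≈b) refl))) one

    derived-⊆-N : ∀ {x} → Derived H x → N x
    derived-⊆-N = commSub-least closure-isSubgroup
      (commutators-∈ closure-isSubgroup H-normalizes-N generator-commutators-∈N)

    metabelian : Metabelian H
    metabelian x y x∈H′ y∈H′ = N-abelian x y (derived-⊆-N x∈H′) (derived-⊆-N y∈H′)

    δ : ℕ × ℕ → Carrier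
    δ (A , B) = powDiff d (p * A) (p * B)

    dᵖᴬ^b : ∀ A → pow d (p * A) ^ b ≈ powDiff d (A * j) (A * l)
    dᵖᴬ^b A = begin
      pow d (p * A) ^ b          ≈⟨ ^-cong (pow-* d p A) refl ⟩
      pow (pow d p) A ^ b        ≈⟨ pow-^ (pow d p) b A ⟩
      pow (pow d p ^ b) A        ≈⟨ pow-cong A dᵖ^b ⟩
      pow (powDiff d j l) A      ≈⟨ pow-powDiff d j l A ⟩
      powDiff d (A * j) (A * l)  ∎

    δ^b : ∀ A B → δ (A , B) ^ b ≈ powDiff d (A * j + B * l) (A * l + B * j)
    δ^b A B = begin
      (pow d (p * A) ∙ pow d (p * B) ⁻¹) ^ b           ≈⟨ ^-homo (pow d (p * A)) _ b ⟩
      pow d (p * A) ^ b ∙ pow d (p * B) ⁻¹ ^ b         ≈⟨ ∙-congˡ (⁻¹-^ (pow d (p * B)) b) ⟩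
      pow d (p * A) ^ b ∙ (pow d (p * B) ^ b) ⁻¹       ≈⟨ ∙-cong (dᵖᴬ^b A) (⁻¹-cong (dᵖᴬ^b B)) ⟩
      powDiff d (A * j) (A * l) ∙ powDiff d (B * j) (B * l) ⁻¹
                                                        ≈⟨ ∙-congˡ (powDiff-⁻¹ d (B * j) (B * l)) ⟩
      powDiff d (A * j) (A * l) ∙ powDiff d (B * l) (B * j)
                                                        ≈⟨ powDiff-∙ d (A * j) (A * l) (B * l) (B * j) ⟩
      powDiff d (A * j + B * l) (A * l + B * j)         ∎

    step : ℕ × ℕ → ℕ × ℕ
    step (A , B) = p * B + (A * j + B * l) , p * A + (A * l + B * j)

    [δ,b]ᵖ : ∀ e → pow [ δ e , b ] p ≈ δ (step e)
    [δ,b]ᵖ (A , B) = begin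
      pow [ δ (A , B) , b ] p                    ≈⟨ pow-cong p ([,]≈⁻¹∙^ (δ (A , B)) b) ⟩
      pow (δ (A , B) ⁻¹ ∙ δ (A , B) ^ b) p
        ≈⟨ pow-cong p (∙-cong (powDiff-⁻¹ d (p * A) (p * B)) (δ^b A B)) ⟩
      pow (powDiff d (p * B) (p * A) ∙ powDiff d (A * j + B * l) (A * l + B * j)) p
        ≈⟨ pow-cong p (powDiff-∙ d (p * B) (p * A) (A * j + B * l) (A * l + B * j)) ⟩
      pow (powDiff d (p * B + (A * j + B * l)) (p * A + (A * l + B * j))) p
        ≈⟨ pow-powDiff d (p * B + (A * j + B * l)) (p * A + (A * l + B * j)) p ⟩
      δ (step (A , B))                           ∎

    exponents : ℕ → ℕ × ℕ
    exponents = fold (1 , 0) step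

    δ∈γ : ∀ n → γ Whole n (δ (exponents n))
    δ∈γ zero    = lift tt
    δ∈γ (suc n) = resp ([δ,b]ᵖ (exponents n))
      (pow∈ closure-isSubgroup p (inc (δ (exponents n) , b , δ∈γ n , lift tt , refl)))

    step-diagonal : ∀ A B → proj₁ (step (A , B)) ≡ proj₂ (step (A , B)) → A ≡ B ⊎ j ≡ p + l
    step-diagonal A B e = m*x+n*y≡m*y+n*x⇒m≡n⊎x≡y A B j (p + l)
      (≡.trans (≡.sym (rearrange q A B j l)) (≡.trans e (rearrange′ q A B j l)))
      where
      rearrange : ∀ q A B j l → suc q * B + (A * j + B * l) ≡ A * j + B * (suc q + l)
      rearrange = solve-∀
      rearrange′ : ∀ q A B j l → suc q * A + (A * l + B * j) ≡ A * (suc q + l) + B * j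
      rearrange′ = solve-∀

    exponents-off-diagonal : ¬ j ≡ p + l → ∀ n → ¬ proj₁ (exponents n) ≡ proj₂ (exponents n)
    exponents-off-diagonal j≢p+l zero    ()
    exponents-off-diagonal j≢p+l (suc n) e with step-diagonal (proj₁ (exponents n)) (proj₂ (exponents n)) e
    ... | inj₁ Aₙ≡Bₙ  = exponents-off-diagonal j≢p+l n Aₙ≡Bₙ
    ... | inj₂ j≡p+l = j≢p+l j≡p+l

    nilpotent⇒j≡p+l : ¬ d ≈ ε → IsNilpotentGroup → j ≡ p + l
    nilpotent⇒j≡p+l d≉ε (n , γₙ-trivial) with j ≟ p + l
    ... | yes j≡p+l = j≡p+l
    ... | no  j≢p+l = ⊥-elim (exponents-off-diagonal j≢p+l n
      (*-cancelˡ-≡ _ _ p (powDiff≈ε⇒≡ d≉ε _ _ (γₙ-trivial _ (δ∈γ n)))))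

    module _ (d^b≈d : d ^ b ≈ d) where

      Zᴴ : Carrier → Set (c ⊔ ℓ)
      Zᴴ = Centralizer Generator

      Zᴴ-sub : IsSubgroup Zᴴ
      Zᴴ-sub = centralizer-isSubgroup Generator

      d∈Zᴴ : Zᴴ d
      d∈Zᴴ (lift (inj₁ g≈a))        = Commute-resp (sym g≈a) refl a⇄d
      d∈Zᴴ (lift (inj₂ (inj₁ g≈b))) = Commute-resp (sym g≈b) refl (Commute-sym (^≈⇒Commute d^b≈d))
      d∈Zᴴ (lift (inj₂ (inj₂ g≈d))) = Commute-resp (sym g≈d) refl refl

      [a,b]≈dˡ⁻ᵏ : [ a , b ] ≈ powDiff d l k
      [a,b]≈dˡ⁻ᵏ = begin
        [ a , b ]                            ≈⟨ [,]≈⁻¹∙^ a b ⟩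
        a ⁻¹ ∙ a ^ b                         ≈⟨ ∙-congˡ a^b ⟩
        a ⁻¹ ∙ (a ∙ pow d l ∙ (pow d k ^ b) ⁻¹) ≈⟨ ∙-congˡ (∙-congˡ (⁻¹-cong dᵏ^b≈dᵏ)) ⟩
        a ⁻¹ ∙ (a ∙ pow d l ∙ pow d k ⁻¹)    ≈⟨ ∙-congˡ (assoc a (pow d l) _) ⟩
        a ⁻¹ ∙ (a ∙ powDiff d l k)           ≈⟨ \\-leftDividesʳ a (powDiff d l k) ⟩
        powDiff d l k                        ∎
        where
        dᵏ^b≈dᵏ : pow d k ^ b ≈ pow d k
        dᵏ^b≈dᵏ = Commute⇒^≈ (Commute-sym (Commute-pow k (Commute-sym (^≈⇒Commute d^b≈d))))

      [a,b]∈Zᴴ : Zᴴ [ a , b ]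
      [a,b]∈Zᴴ = ∈-resp Zᴴ-sub (sym [a,b]≈dˡ⁻ᵏ)
        (∙∈ Zᴴ-sub (pow∈ Zᴴ-sub l d∈Zᴴ) (⁻¹∈ Zᴴ-sub (pow∈ Zᴴ-sub k d∈Zᴴ)))

      commuting-central : ∀ {g h} → Commute g h → Zᴴ [ g , h ]
      commuting-central g⇄h = ∈-resp Zᴴ-sub (sym (Commute⇒[,]≈ε g⇄h)) (ε∈ Zᴴ-sub)

      generator-commutators-central : ∀ {g h} → Generator g → Generator h → Zᴴ [ g , h ]
      generator-commutators-central (lift (inj₂ (inj₂ g≈d))) h-gen =
        commuting-central (Commute-resp (sym g≈d) refl (Commute-sym (d∈Zᴴ h-gen)))
      generator-commutators-central g-gen (lift (inj₂ (inj₂ h≈d))) =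
        commuting-central (Commute-resp refl (sym h≈d) (d∈Zᴴ g-gen))
      generator-commutators-central (lift (inj₁ g≈a)) (lift (inj₁ h≈a)) =
        commuting-central (Commute-resp (sym g≈a) (sym h≈a) refl)
      generator-commutators-central (lift (inj₂ (inj₁ g≈b))) (lift (inj₂ (inj₁ h≈b))) =
        commuting-central (Commute-resp (sym g≈b) (sym h≈b) refl)
      generator-commutators-central (lift (inj₁ g≈a)) (lift (inj₂ (inj₁ h≈b))) =
        ∈-resp Zᴴ-sub ([,]-cong (sym g≈a) (sym h≈b)) [a,b]∈Zᴴ
      generator-commutators-central (lift (inj₂ (inj₁ g≈b))) (lift (inj₁ h≈a)) =
        ∈-resp Zᴴ-sub (trans (sym ([,]-swap a b)) ([,]-cong (sym g≈b) (sym h≈a))) (⁻¹∈ Zᴴ-sub [a,b]∈Zᴴ)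

      H-fixes-Zᴴ : ∀ {x z} → H x → Zᴴ z → Zᴴ (z ^ x)
      H-fixes-Zᴴ x∈H z∈Zᴴ = ∈-resp Zᴴ-sub (sym (Commute⇒^≈ (Commute-sym (centralizer-closure z∈Zᴴ x∈H)))) z∈Zᴴ

      class≤2 : NilpotentClass≤ H 2
      class≤2 x = commSub-least trivial-isSubgroup λ z∈H′ y∈H →
        Commute⇒[,]≈ε (Commute-sym (centralizer-closure (H′⊆Zᴴ z∈H′) y∈H))
        where
        H′⊆Zᴴ : ∀ {z} → Derived H z → Zᴴ z
        H′⊆Zᴴ = commSub-least Zᴴ-sub (commutators-∈ Zᴴ-sub H-fixes-Zᴴ generator-commutators-central)

    j≡p+l⇒d^b≈d : j ≡ p + l → d ^ b ≈ d
    j≡p+l⇒d^b≈d j≡p+l = pow-suc-injective q (begin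
      pow (d ^ b) p          ≈⟨ pow-^ d b p ⟨
      pow d p ^ b            ≈⟨ dᵖ^b ⟩
      powDiff d j l          ≡⟨ ≡.cong (λ i → powDiff d i l) j≡p+l ⟩
      powDiff d (p + l) l    ≈⟨ powDiff-+ d p l ⟩
      pow d p                ∎)

    metabelian×class≤2 : ¬ d ≈ ε → Metabelian H × (IsNilpotentGroup → NilpotentClass≤ H 2)
    metabelian×class≤2 d≉ε =
      metabelian , λ nilpotent → class≤2 (j≡p+l⇒d^b≈d (nilpotent⇒j≡p+l d≉ε nilpotent))

  ordered-relations⇒metabelian×class≤2 :
    ∀ (a b d : Carrier) → Commute a d → ¬ d ≈ ε → ∀ i j k l → i < k →
    (a ∙ pow d i) ^ b ≈ a ∙ pow d j → (a ∙ pow d k) ^ b ≈ a ∙ pow d l →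
    Metabelian (Gen3 a b d) × (IsNilpotentGroup → NilpotentClass≤ (Gen3 a b d) 2)
  ordered-relations⇒metabelian×class≤2 a b d a⇄d d≉ε i j k l i<k relᵢ relₖ with m≤n⇒∃[o]m+o≡n i<k
  ... | q , ≡.refl = metabelian×class≤2 a b d a⇄d i q l j relᵢ
    (≡.subst (λ m → (a ∙ pow d m) ^ b ≈ a ∙ pow d l) (≡.sym (+-suc i q)) relₖ) d≉ε

  distinct-translates⇒≉ε : ∀ {a d} i k → ¬ a ∙ pow d i ≈ a ∙ pow d k → ¬ d ≈ ε
  distinct-translates⇒≉ε i k distinct d≈ε = distinct (∙-congˡ (begin
    pow _ i  ≈⟨ trans (pow-cong i d≈ε) (pow-ε i) ⟩
    ε        ≈⟨ trans (pow-cong k d≈ε) (pow-ε k) ⟨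
    pow _ k  ∎))

  two-relations⇒metabelian×class≤2 :
    ∀ (a b d : Carrier) → Commute a d → ∀ i j k l → ¬ a ∙ pow d i ≈ a ∙ pow d k →
    (a ∙ pow d i) ^ b ≈ a ∙ pow d j → (a ∙ pow d k) ^ b ≈ a ∙ pow d l →
    Metabelian (Gen3 a b d) × (IsNilpotentGroup → NilpotentClass≤ (Gen3 a b d) 2)
  two-relations⇒metabelian×class≤2 a b d a⇄d i j k l distinct relᵢ relₖ with <-cmp i k
  ... | tri< i<k _ _    = ordered-relations⇒metabelian×class≤2 a b d a⇄d
                            (distinct-translates⇒≉ε i k distinct) i j k l i<k relᵢ relₖ
  ... | tri≈ _ ≡.refl _ = ⊥-elim (distinct refl)
  ... | tri> _ _ k<i    = ordered-relations⇒metabelian×class≤2 a b d a⇄d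
                            (distinct-translates⇒≉ε i k distinct) k l i j k<i relₖ relᵢ

lemma9p1 : {c ℓ ℓ₂ t : Level} (OG : OrderedGroup c ℓ ℓ₂) →
    let open OrderedGroup OG hiding (_≤_) in
    let open GroupNotions group in
    (a b d : Carrier) → [ a , d ] ≈ ε →
    (T : Carrier → Set t) (h : ℕ) → 1 ≤ h →
    (∀ x → T x → Σ ℕ λ i → (i ≤ h) × (x ≈ a ∙ pow d i)) →
    ¬ (Σ Carrier λ x → T x × (x ≈ b)) →
    (Σ Carrier λ u → Σ Carrier λ v → Σ Carrier λ s₁ → Σ Carrier λ t₁ →
       Σ Carrier λ s₂ → Σ Carrier λ t₂ →
       T s₁ × T t₁ × T s₂ × T t₂ ×
       (u ≈ s₁ ∙ b) × (u ≈ b ∙ t₁) × (v ≈ s₂ ∙ b) × (v ≈ b ∙ t₂) × ¬ (u ≈ v)) →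
    Metabelian (Gen3 a b d) × (IsNilpotentGroup → NilpotentClass≤ (Gen3 a b d) 2)
lemma9p1 OG a b d [a,d]≈ε _ _ _ T⊆aⁱ _
  (u , v , s₁ , t₁ , s₂ , t₂ , s₁∈T , t₁∈T , s₂∈T , t₂∈T , u≈s₁b , u≈bt₁ , v≈s₂b , v≈bt₂ , u≉v)
  with T⊆aⁱ s₁ s₁∈T | T⊆aⁱ t₁ t₁∈T | T⊆aⁱ s₂ s₂∈T | T⊆aⁱ t₂ t₂∈T
... | i , _ , s₁≈ | j , _ , t₁≈ | k , _ , s₂≈ | l , _ , t₂≈ =
  two-relations⇒metabelian×class≤2 a b d ([,]≈ε⇒Commute [a,d]≈ε) i j k l
    (λ aⁱ≈aᵏ → u≉v (trans u≈s₁b (trans (∙-congʳ (trans s₁≈ (trans aⁱ≈aᵏ (sym s₂≈)))) (sym v≈s₂b))))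
    (∙≈∙⇒^≈ b (trans (∙-congʳ (sym s₁≈)) (trans (sym u≈s₁b) (trans u≈bt₁ (∙-congˡ t₁≈)))))
    (∙≈∙⇒^≈ b (trans (∙-congʳ (sym s₂≈)) (trans (sym v≈s₂b) (trans v≈bt₂ (∙-congˡ t₂≈)))))
  where
  open OrderedGroup OG hiding (_≤_)
  open GroupTheory group
  open TranslateRelations OG
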